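{- Let $n\ge1$ and $m\ge1$ be integers and for integers $v\ge0$ define \[ P(v)=\frac{4^{v+1}}{2(2m)^n}\sum_{a=0}^{n-1}\binom{n+m-1-a}{n}\binom{n-1-2v}{a-v}. \] Then $P(v)\ge P(v+1)$ for all integers $v$ with $0\le v\le (n-1)/2$. (Here $P(v)$ is the probability that a shelf shuffle with $m$ shelves of $n$ cards yields any fixed permutation having $v$ valleys; in particular this probability is nonincreasing in the number of valleys.)
   Context: Binomial coefficients $\binom{k}{j}$ are taken to be $0$ unless $0\le j\le k$ (in particular they vanish when $k<0$). Shelf shuffle with $m$ shelves: each of the cards $1,\dots,n$ (initially in order from top) independently gets a uniform label in $\{1,\dots,2m\}$; the new deck consists, from top to bottom, of the packets of cards with label $1,2,\dots,2m$, the packet with label $j$ in increasing order if $j$ is odd and in decreasing order if $j$ is even. A valley of $w\in S_n$ is an index $1<i<n$ with $w(i-1)>w(i)<w(i+1)$. -}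

module Defs where

open import Data.Nat as ℕ using (ℕ; zero; suc; _≤_; NonZero; >-nonZero)
open import Data.Nat.Properties using (m*n≢0; m^n≢0)
open import Data.Nat.Combinatorics using (_C_)
open import Data.Integer as ℤ using (ℤ; +_; -[1+_])
open import Data.List using (List; upTo; map; foldr)
open import Data.Rational as ℚ using (ℚ; _/_)

-- Integer-indexed binomial coefficient, as in the paper's convention:
-- binom k j = 0 unless 0 ≤ j ≤ k (in particular 0 when k < 0).
-- For naturals, the stdlib's  k C j  is already 0 when j > k.
binomℤ : ℤ → ℤ → ℤ
binomℤ (+ k)    (+ j)    = + (k C j)
binomℤ (+ k)    -[1+ _ ] = + 0
binomℤ -[1+ _ ] _        = + 0

sumℤ : List ℤ → ℤ
sumℤ = foldr ℤ._+_ (+ 0)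

S : ℕ → ℕ → ℕ → ℤ
S n m v = sumℤ (map term (upTo n))
  where
  term : ℕ → ℤ
  term a = binomℤ (+ n ℤ.+ + m ℤ.- + 1 ℤ.- + a) (+ n)
           ℤ.* binomℤ (+ n ℤ.- + 1 ℤ.- + (2 ℕ.* v)) (+ a ℤ.- + v)

P : (n m : ℕ) → 1 ≤ m → ℕ → ℚ
P n m 1≤m v =
  (+ (4 ℕ.^ (v ℕ.+ 1)) / denom) ℚ.* (S n m v / 1)
  where
  instance
    nzm : NonZero m
    nzm = >-nonZero 1≤m
  denom : ℕ
  denom = 2 ℕ.* (2 ℕ.* m) ℕ.^ n
  instance
    nz2m : NonZero (2 ℕ.* m)
    nz2m = m*n≢0 2 m
    nzp : NonZero ((2 ℕ.* m) ℕ.^ n)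
    nzp = m^n≢0 (2 ℕ.* m) n
    nzd : NonZero denom
    nzd = m*n≢0 2 ((2 ℕ.* m) ℕ.^ n)

module Submission where

-- Write n = n' + 1 and fix m.  Substituting j = a - v in the defining sum,
--   S(n,m,v) = Σ_j C(N,j) · g_v(j),   N = n' - 2v,   g_v(j) = C(n'+m-(v+j), n),
-- i.e. S(v) is the binomial transform T_N g_v of the weight sequence g_v.
-- Two structural facts then give the theorem:
--   * Pascal's rule applied twice gives T_{N+2} g = T_N g + 2 T_N g' + T_N g''
--     (g' the shifted sequence), so for a convex g we get 4 T_N g' ≤ T_{N+2} g;
--   * a ↦ C(Y - a, k) is convex (columns of Pascal's triangle are convex).
-- Since g_{v+1} = g_v' and N drops by 2 from v to v+1, this yields
-- 4 S(v+1) ≤ S(v); when n' < 2(v+1) the sum S(v+1) vanishes outright because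
-- its binomial coefficients have negative upper index.  Finally
-- P(v+1) / P(v) = 4 S(v+1) / S(v), which is a statement about fractions.

open import Defs
open import Data.Nat using (ℕ; _≤_; _+_; _*_; _∸_)
open import Data.Rational using (_≥_)
open import Data.Nat using (zero; suc; _<_; _^_; z≤n; s≤s; NonZero; >-nonZero)
open import Data.Nat.Properties
open import Data.Nat.Tactic.RingSolver using (solve-∀)
open import Data.Nat.Combinatorics using (_C_; nCk+nC[k+1]≡[n+1]C[k+1])
open import Data.Integer as ℤ using (ℤ; +_; -[1+_]; _⊖_)
import Data.Integer.Properties as ℤP
open import Data.Rational as ℚ using (_/_; toℚᵘ)
open import Data.Rational.Properties using (toℚᵘ-cancel-≤; toℚᵘ-homo-*; toℚᵘ-fromℚᵘ)
open import Data.Rational.Unnormalised as ℚᵘ using (mkℚᵘ; *≤*)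
import Data.Rational.Unnormalised.Properties as ℚᵘP
open import Data.List using (map; upTo; applyUpTo)
open import Data.List.Properties using (map-upTo)
open import Data.Product using (Σ-syntax; _×_; _,_)
open import Function using (_∘_)
open import Relation.Binary.PropositionalEquality

sum< : ℕ → (ℕ → ℕ) → ℕ
sum< zero    h = 0
sum< (suc L) h = h 0 + sum< L (h ∘ suc)

sum<-cong : ∀ L {h h′ : ℕ → ℕ} → (∀ j → h j ≡ h′ j) → sum< L h ≡ sum< L h′
sum<-cong zero    e = refl
sum<-cong (suc L) e = cong₂ _+_ (e 0) (sum<-cong L (e ∘ suc))

sum<-zero : ∀ L → sum< L (λ _ → 0) ≡ 0
sum<-zero zero    = refl
sum<-zero (suc L) = sum<-zero L

sum<-+ : ∀ L (h k : ℕ → ℕ) → sum< L (λ j → h j + k j) ≡ sum< L h + sum< L k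
sum<-+ zero    h k = refl
sum<-+ (suc L) h k = begin
  h 0 + k 0 + sum< L (λ j → h (suc j) + k (suc j))  ≡⟨ cong (_+_ (h 0 + k 0)) (sum<-+ L (h ∘ suc) (k ∘ suc)) ⟩
  h 0 + k 0 + (sum< L (h ∘ suc) + sum< L (k ∘ suc)) ≡⟨ interchange (h 0) (k 0) _ _ ⟩
  h 0 + sum< L (h ∘ suc) + (k 0 + sum< L (k ∘ suc)) ∎
  where
  open ≡-Reasoning
  interchange : ∀ x y z w → x + y + (z + w) ≡ x + z + (y + w)
  interchange = solve-∀

-- The binomial transform  T N g = Σ_j C(N,j) g(j), defined through Pascal's
-- rule so that T (N+1) g = T N g + T N (g ∘ suc) holds by definition.
T : ℕ → (ℕ → ℕ) → ℕ
T zero    g = g 0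
T (suc N) g = T N g + T N (g ∘ suc)

-- Pascal's rule splits the order-(N+1) sum into the order-N sum of g over
-- L+1 terms and the order-N sum of g ∘ suc over L terms.
T-as-sum : ∀ N L g → N < L → sum< L (λ j → g j * (N C j)) ≡ T N g
T-as-sum zero (suc L) g _ = begin
  g 0 * 1 + sum< L (λ j → g (suc j) * 0)  ≡⟨ cong (_+_ (g 0 * 1)) (sum<-cong L (λ j → *-zeroʳ (g (suc j)))) ⟩
  g 0 * 1 + sum< L (λ _ → 0)              ≡⟨ cong₂ _+_ (*-identityʳ (g 0)) (sum<-zero L) ⟩
  g 0 + 0                                 ≡⟨ +-identityʳ (g 0) ⟩
  g 0                                     ∎
  where open ≡-Reasoning
T-as-sum (suc N) (suc L) g (s≤s N<L) = begin
  g 0 * 1 + sum< L (λ j → g (suc j) * (suc N C suc j))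
    ≡⟨ cong (_+_ (g 0 * 1)) (sum<-cong L pascal) ⟩
  g 0 * 1 + sum< L (λ j → g (suc j) * (N C j) + g (suc j) * (N C suc j))
    ≡⟨ cong (_+_ (g 0 * 1)) (sum<-+ L _ _) ⟩
  g 0 * 1 + (X + Y)
    ≡⟨ regroup (g 0 * 1) X Y ⟩
  (g 0 * (N C 0) + Y) + X
    ≡⟨ cong₂ _+_ (T-as-sum N (suc L) g (m≤n⇒m≤1+n N<L)) (T-as-sum N L (g ∘ suc) N<L) ⟩
  T N g + T N (g ∘ suc)
    ∎
  where
  open ≡-Reasoning
  X Y : ℕ
  X = sum< L (λ j → g (suc j) * (N C j))
  Y = sum< L (λ j → g (suc j) * (N C suc j))
  pascal : ∀ j → g (suc j) * (suc N C suc j) ≡ g (suc j) * (N C j) + g (suc j) * (N C suc j)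
  pascal j = trans (cong (g (suc j) *_) (sym (nCk+nC[k+1]≡[n+1]C[k+1] N j)))
                   (*-distribˡ-+ (g (suc j)) (N C j) (N C suc j))
  regroup : ∀ x y z → x + (y + z) ≡ (x + z) + y
  regroup = solve-∀

T-cong : ∀ N {g h : ℕ → ℕ} → (∀ j → g j ≡ h j) → T N g ≡ T N h
T-cong zero    e = e 0
T-cong (suc N) e = cong₂ _+_ (T-cong N e) (T-cong N (e ∘ suc))

T-mono : ∀ N {g h : ℕ → ℕ} → (∀ j → g j ≤ h j) → T N g ≤ T N h
T-mono zero    le = le 0
T-mono (suc N) le = +-mono-≤ (T-mono N le) (T-mono N (le ∘ suc))

T-+ : ∀ N (g h : ℕ → ℕ) → T N (λ j → g j + h j) ≡ T N g + T N h
T-+ zero    g h = refl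
T-+ (suc N) g h = trans (cong₂ _+_ (T-+ N g h) (T-+ N (g ∘ suc) (h ∘ suc)))
                        (interchange (T N g) (T N h) _ _)
  where
  interchange : ∀ x y z w → x + y + (z + w) ≡ x + z + (y + w)
  interchange = solve-∀

-- Key inequality: for a convex sequence g,  4 T_N (g ∘ suc) ≤ T_{N+2} g,
-- because T_{N+2} g = T_N g + 2 T_N (g ∘ suc) + T_N (g ∘ suc ∘ suc).
T-convex : ∀ N g → (∀ j → g (suc j) + g (suc j) ≤ g j + g (suc (suc j))) →
           4 * T N (g ∘ suc) ≤ T (suc (suc N)) g
T-convex N g convex = begin
  4 * B                                                 ≡⟨ four-times B ⟩
  (B + B) + (B + B)                                     ≡⟨ cong (_+ (B + B)) (T-+ N (g ∘ suc) (g ∘ suc)) ⟨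
  T N (λ j → g (suc j) + g (suc j)) + (B + B)           ≤⟨ +-monoˡ-≤ (B + B) (T-mono N convex) ⟩
  T N (λ j → g j + g (suc (suc j))) + (B + B)           ≡⟨ cong (_+ (B + B)) (T-+ N g (g ∘ suc ∘ suc)) ⟩
  (A + D) + (B + B)                                     ≡⟨ regroup A B D ⟩
  (A + B) + (B + D)                                     ∎
  where
  open ≤-Reasoning
  A B D : ℕ
  A = T N g
  B = T N (g ∘ suc)
  D = T N (g ∘ suc ∘ suc)
  four-times : ∀ b → 4 * b ≡ (b + b) + (b + b)
  four-times = solve-∀
  regroup : ∀ a b d → (a + d) + (b + b) ≡ (a + b) + (b + d)
  regroup = solve-∀

C-mono : ∀ x k → x C k ≤ suc x C k
C-mono x zero    = ≤-refl
C-mono x (suc k) = subst (x C suc k ≤_) (nCk+nC[k+1]≡[n+1]C[k+1] x k) (m≤n+m _ _)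

C-convex : ∀ x k → suc x C k + suc x C k ≤ suc (suc x) C k + x C k
C-convex x zero    = ≤-refl
C-convex x (suc k) = begin
  Q + Q                                 ≡⟨ cong (_+ Q) (nCk+nC[k+1]≡[n+1]C[k+1] x k) ⟨
  (x C k + x C suc k) + Q               ≤⟨ +-monoˡ-≤ Q (+-monoˡ-≤ (x C suc k) (C-mono x k)) ⟩
  (suc x C k + x C suc k) + Q           ≡⟨ regroup (suc x C k) (x C suc k) Q ⟩
  (suc x C k + Q) + x C suc k           ≡⟨ cong (_+ x C suc k) (nCk+nC[k+1]≡[n+1]C[k+1] (suc x) k) ⟩
  suc (suc x) C suc k + x C suc k       ∎
  where
  open ≤-Reasoning
  Q : ℕ
  Q = suc x C suc k
  regroup : ∀ a b c → (a + b) + c ≡ (a + c) + b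
  regroup = solve-∀

descC : ℕ → ℕ → ℕ → ℕ
descC Y k a = (Y ∸ a) C k

-- a ↦ C(Y - a, k) is convex on all of ℕ: in the range a + 2 ≤ Y this is
-- C-convex, and at the point where Y - a reaches 0 it is C-mono.
descC-convex : ∀ Y k a → descC Y k (suc a) + descC Y k (suc a) ≤ descC Y k a + descC Y k (suc (suc a))
descC-convex zero          k zero    = ≤-refl
descC-convex zero          k (suc a) = ≤-refl
descC-convex (suc zero)    k zero    = +-monoˡ-≤ (0 C k) (C-mono 0 k)
descC-convex (suc (suc x)) k zero    = C-convex x k
descC-convex (suc Y)       k (suc a) = descC-convex Y k a

-- Binomial coefficients with a shifted lower index:  Cshift w N a = C(N, a - w),
-- which is 0 when a < w.
Cshift : ℕ → ℕ → ℕ → ℕ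
Cshift zero    N a       = N C a
Cshift (suc w) N zero    = 0
Cshift (suc w) N (suc a) = Cshift w N a

binomℤ-shift : ∀ N w a → binomℤ (+ N) (+ a ℤ.- + w) ≡ + Cshift w N a
binomℤ-shift N w a = trans (cong (binomℤ (+ N)) (ℤP.m-n≡m⊖n a w)) (shifted w a)
  where
  shifted : ∀ w a → binomℤ (+ N) (a ⊖ w) ≡ + Cshift w N a
  shifted zero    a       = cong (binomℤ (+ N)) (ℤP.⊖-≥ {a} {0} z≤n)
  shifted (suc w) zero    = cong (binomℤ (+ N)) (ℤP.⊖-< {0} {suc w} (s≤s z≤n))
  shifted (suc w) (suc a) = trans (cong (binomℤ (+ N)) (ℤP.[1+m]⊖[1+n]≡m⊖n a w)) (shifted w a)

sum<-Cshift : ∀ N w L (h : ℕ → ℕ) →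
              sum< (w + L) (λ a → h a * Cshift w N a) ≡ sum< L (λ j → h (w + j) * (N C j))
sum<-Cshift N zero    L h = refl
sum<-Cshift N (suc w) L h =
  trans (cong (_+ sum< (w + L) (λ a → h (suc a) * Cshift w N a)) (*-zeroʳ (h 0)))
        (sum<-Cshift N w L (h ∘ suc))

binomℤ-negative : ∀ {z} y → z ℤ.< + 0 → binomℤ z y ≡ + 0
binomℤ-negative { -[1+ _ ]} y _          = refl
binomℤ-negative {+ _}      y (ℤ.+<+ ())

pos-minus : ∀ {x y} → y ≤ x → + x ℤ.- + y ≡ + (x ∸ y)
pos-minus {x} {y} y≤x = trans (ℤP.m-n≡m⊖n x y) (ℤP.⊖-≥ y≤x)

pos-minus-negative : ∀ {x y} → x < y → + x ℤ.- + y ℤ.< + 0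
pos-minus-negative {x} {y} x<y =
  subst₂ ℤ._<_ (sym (ℤP.m-n≡m⊖n x y)) (ℤP.n⊖n≡0 x) (ℤP.⊖-monoʳ->-< x x<y)

sumℤ-as-sum< : ∀ L (t : ℕ → ℤ) (h : ℕ → ℕ) → (∀ a → a < L → t a ≡ + h a) →
               sumℤ (map t (upTo L)) ≡ + sum< L h
sumℤ-as-sum< L t h e = trans (cong sumℤ (map-upTo t L)) (go L t h e)
  where
  go : ∀ L (t : ℕ → ℤ) (h : ℕ → ℕ) → (∀ a → a < L → t a ≡ + h a) →
       sumℤ (applyUpTo t L) ≡ + sum< L h
  go zero    t h e = refl
  go (suc L) t h e = cong₂ ℤ._+_ (e 0 (s≤s z≤n)) (go L (t ∘ suc) (h ∘ suc) (λ a → e (suc a) ∘ s≤s))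

S-as-T : ∀ N m w → S (suc (N + 2 * w)) m w ≡ + T N (λ j → descC (N + 2 * w + m) (suc (N + 2 * w)) (w + j))
S-as-T N m w = begin
  S (suc n′) m w
    ≡⟨ sumℤ-as-sum< (suc n′) _ (λ a → h a * Cshift w N a) term ⟩
  + sum< (suc n′) (λ a → h a * Cshift w N a)
    ≡⟨ cong (λ L → + sum< L (λ a → h a * Cshift w N a)) length ⟩
  + sum< (w + suc (N + w)) (λ a → h a * Cshift w N a)
    ≡⟨ cong +_ (sum<-Cshift N w (suc (N + w)) h) ⟩
  + sum< (suc (N + w)) (λ j → h (w + j) * (N C j))
    ≡⟨ cong +_ (T-as-sum N (suc (N + w)) (λ j → h (w + j)) (s≤s (m≤m+n N w))) ⟩
  + T N (λ j → h (w + j))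
    ∎
  where
  open ≡-Reasoning
  n′ : ℕ
  n′ = N + 2 * w
  h : ℕ → ℕ
  h = descC (n′ + m) (suc n′)
  length : suc n′ ≡ w + suc (N + w)
  length = split N w
    where
    split : ∀ N w → suc (N + 2 * w) ≡ w + suc (N + w)
    split = solve-∀
  upper : + n′ ℤ.- + (2 * w) ≡ + N
  upper = trans (pos-minus (m≤n+m (2 * w) N)) (cong +_ (m+n∸n≡m N (2 * w)))
  term : ∀ a → a < suc n′ →
         binomℤ (+ (n′ + m) ℤ.- + a) (+ suc n′) ℤ.* binomℤ (+ n′ ℤ.- + (2 * w)) (+ a ℤ.- + w)
         ≡ + (h a * Cshift w N a)
  term a (s≤s a≤n′) = begin
    binomℤ (+ (n′ + m) ℤ.- + a) (+ suc n′) ℤ.* binomℤ (+ n′ ℤ.- + (2 * w)) (+ a ℤ.- + w)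
      ≡⟨ cong₂ (λ x y → binomℤ x (+ suc n′) ℤ.* binomℤ y (+ a ℤ.- + w))
               (pos-minus (≤-trans a≤n′ (m≤m+n n′ m))) upper ⟩
    + h a ℤ.* binomℤ (+ N) (+ a ℤ.- + w)
      ≡⟨ cong (+ h a ℤ.*_) (binomℤ-shift N w a) ⟩
    + h a ℤ.* + Cshift w N a
      ≡⟨ ℤP.pos-* (h a) (Cshift w N a) ⟨
    + (h a * Cshift w N a)
      ∎

-- When 2w > n - 1 every term of S has negative upper index, so S vanishes.
S-vanishes : ∀ n′ m w → n′ < 2 * w → S (suc n′) m w ≡ + 0
S-vanishes n′ m w n′<2w =
  trans (sumℤ-as-sum< (suc n′) _ (λ _ → 0) term) (cong +_ (sum<-zero (suc n′)))
  where
  term : ∀ a → a < suc n′ →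
         binomℤ (+ (n′ + m) ℤ.- + a) (+ suc n′) ℤ.* binomℤ (+ n′ ℤ.- + (2 * w)) (+ a ℤ.- + w) ≡ + 0
  term a _ = trans (cong (binomℤ (+ (n′ + m) ℤ.- + a) (+ suc n′) ℤ.*_)
                         (binomℤ-negative (+ a ℤ.- + w) (pos-minus-negative n′<2w)))
                   (ℤP.*-zeroʳ (binomℤ (+ (n′ + m) ℤ.- + a) (+ suc n′)))

S-step : ∀ N m v → Σ[ s₀ ∈ ℕ ] Σ[ s₁ ∈ ℕ ]
         S (suc (N + 2 * v)) m v ≡ + s₀ × S (suc (N + 2 * v)) m (v + 1) ≡ + s₁ × 4 * s₁ ≤ s₀
S-step zero          m v = _ , 0 , S-as-T 0 m v , S-vanishes (2 * v) m (v + 1) (2v<2[v+1] v) , z≤n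
  where
  2v<2[v+1] : ∀ v → 2 * v < 2 * (v + 1)
  2v<2[v+1] v = *-monoʳ-< 2 (m<m+n v (s≤s z≤n))
S-step (suc zero)    m v = _ , 0 , S-as-T 1 m v , S-vanishes (1 + 2 * v) m (v + 1) (1+2v<2[v+1] v) , z≤n
  where
  1+2v<2[v+1] : ∀ v → 1 + 2 * v < 2 * (v + 1)
  1+2v<2[v+1] v = ≤-reflexive (double-suc v)
    where
    double-suc : ∀ v → 2 + 2 * v ≡ 2 * (v + 1)
    double-suc = solve-∀
S-step (suc (suc N)) m v = _ , _ , S-as-T (2 + N) m v , S-next , four-S-next≤S
  where
  n′ : ℕ
  n′ = 2 + N + 2 * v
  g : ℕ → ℕ
  g j = descC (n′ + m) (suc n′) (v + j)
  same-n : N + 2 * (v + 1) ≡ n′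
  same-n = shift-two N v
    where
    shift-two : ∀ N v → N + 2 * (v + 1) ≡ 2 + N + 2 * v
    shift-two = solve-∀
  S-next : S (suc n′) m (v + 1) ≡ + T N (λ j → descC (n′ + m) (suc n′) ((v + 1) + j))
  S-next = subst (λ n″ → S (suc n″) m (v + 1) ≡ + T N (λ j → descC (n″ + m) (suc n″) ((v + 1) + j)))
                 same-n (S-as-T N m (v + 1))
  g-convex : ∀ j → g (suc j) + g (suc j) ≤ g j + g (suc (suc j))
  g-convex j rewrite +-suc v (suc j) | +-suc v j = descC-convex (n′ + m) (suc n′) (v + j)
  four-S-next≤S : 4 * T N (λ j → descC (n′ + m) (suc n′) ((v + 1) + j)) ≤ T (2 + N) g
  four-S-next≤S = subst (λ t → 4 * t ≤ T (2 + N) g)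
                        (T-cong N (λ j → cong (descC (n′ + m) (suc n′)) (sym (+-assoc v 1 j))))
                        (T-convex N g g-convex)

fraction-product-≤ : ∀ a b c e d .{{_ : NonZero d}} → a * b ≤ c * e →
                     (+ a / d) ℚ.* (+ b / 1) ℚ.≤ (+ c / d) ℚ.* (+ e / 1)
fraction-product-≤ a b c e (suc k) ab≤ce = toℚᵘ-cancel-≤ (begin
  toℚᵘ ((+ a / suc k) ℚ.* (+ b / 1))       ≃⟨ toℚᵘ-homo-* (+ a / suc k) (+ b / 1) ⟩
  toℚᵘ (+ a / suc k) ℚᵘ.* toℚᵘ (+ b / 1)   ≃⟨ ℚᵘP.*-cong (toℚᵘ-fromℚᵘ (mkℚᵘ (+ a) k)) (toℚᵘ-fromℚᵘ (mkℚᵘ (+ b) 0)) ⟩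
  mkℚᵘ (+ a) k ℚᵘ.* mkℚᵘ (+ b) 0           ≤⟨ same-denominator ⟩
  mkℚᵘ (+ c) k ℚᵘ.* mkℚᵘ (+ e) 0           ≃⟨ ℚᵘP.*-cong (toℚᵘ-fromℚᵘ (mkℚᵘ (+ c) k)) (toℚᵘ-fromℚᵘ (mkℚᵘ (+ e) 0)) ⟨
  toℚᵘ (+ c / suc k) ℚᵘ.* toℚᵘ (+ e / 1)   ≃⟨ toℚᵘ-homo-* (+ c / suc k) (+ e / 1) ⟨
  toℚᵘ ((+ c / suc k) ℚ.* (+ e / 1))       ∎)
  where
  open ℚᵘP.≤-Reasoning
  same-denominator : mkℚᵘ (+ a) k ℚᵘ.* mkℚᵘ (+ b) 0 ℚᵘ.≤ mkℚᵘ (+ c) k ℚᵘ.* mkℚᵘ (+ e) 0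
  same-denominator = *≤* (ℤP.*-monoʳ-≤-nonNeg (+ (suc k * 1))
    (subst₂ ℤ._≤_ (ℤP.pos-* a b) (ℤP.pos-* c e) (ℤ.+≤+ ab≤ce)))

-- Then P(v+1) = (4^{v+2}/d)·S(v+1) and
-- P(v) = (4^{v+1}/d)·S(v) with d = 2(2m)^n, so the claim reduces to
-- 4^{v+1}·(4 S(v+1)) ≤ 4^{v+1}·S(v), i.e. to the core inequality S-step.
corollary3p4 : (n m : ℕ) → 1 ≤ n → (1≤m : 1 ≤ m) →
    (v : ℕ) → 2 * v ≤ n ∸ 1 →
    P n m 1≤m v ≥ P n m 1≤m (v + 1)
corollary3p4 (suc n′) m _ 1≤m v 2v≤n′
  with n′ ∸ 2 * v | m∸n+n≡m 2v≤n′
... | N | refl with S-step N m v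
... | s₀ , s₁ , S≡s₀ , S-next≡s₁ , 4s₁≤s₀ rewrite S≡s₀ | S-next≡s₁ =
  fraction-product-≤ (4 ^ (v + 1 + 1)) s₁ (4 ^ (v + 1)) s₀ (2 * (2 * m) ^ suc (N + 2 * v))
    {{m*n≢0 2 ((2 * m) ^ suc (N + 2 * v))}} powers
  where
  instance
    m≢0 : NonZero m
    m≢0 = >-nonZero 1≤m
    2m≢0 : NonZero (2 * m)
    2m≢0 = m*n≢0 2 m
    power≢0 : NonZero ((2 * m) ^ suc (N + 2 * v))
    power≢0 = m^n≢0 (2 * m) (suc (N + 2 * v))
  powers : 4 ^ (v + 1 + 1) * s₁ ≤ 4 ^ (v + 1) * s₀
  powers = begin
    4 ^ (v + 1 + 1) * s₁     ≡⟨ cong (λ e → 4 ^ e * s₁) (+-comm (v + 1) 1) ⟩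
    4 * 4 ^ (v + 1) * s₁     ≡⟨ regroup (4 ^ (v + 1)) s₁ ⟩
    4 ^ (v + 1) * (4 * s₁)   ≤⟨ *-monoʳ-≤ (4 ^ (v + 1)) 4s₁≤s₀ ⟩
    4 ^ (v + 1) * s₀         ∎
    where
    open ≤-Reasoning
    regroup : ∀ x s → 4 * x * s ≡ x * (4 * s)
    regroup = solve-∀
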